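{- Let $k\ge 0$ be an integer, let $p_1,\dots,p_k$ be distinct primes, and let $\Gamma_k$ be the $k$-dprime divisor function graph of $n=p_1p_2\cdots p_k$. Then the hyper-Wiener index of $\Gamma_k$ is $$WW(\Gamma_k)=2^{k-1}\bigl(2^{k+1}+2^k+1\bigr)-2\cdot 3^k.$$
   Context: For $n=p_1p_2\cdots p_k$ with $p_1,\dots,p_k$ distinct primes, the $k$-dprime divisor function graph $\Gamma_k=G_{D(n)}$ is the simple graph with vertex set $V(\Gamma_k)=\{u\in\mathbb{Z}_{>0}: u\mid n\}$ and edge set $E(\Gamma_k)=\{uv: u\neq v,\ u\mid v \text{ or } v\mid u\}$. The hyper-Wiener index is $WW(\Gamma_k)=\frac12\sum_{\{u,v\}\subseteq V(\Gamma_k)}\bigl[d_{\Gamma_k}(u,v)+d_{\Gamma_k}(u,v)^2\bigr]$, summed over unordered pairs of distinct vertices, where $d_{\Gamma_k}$ is the shortest-path distance. -}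

module Defs where

open import Data.Bool using (Bool; true; false; _∧_; _∨_; not; if_then_else_)
open import Data.Nat using (ℕ; zero; suc; _+_; _*_; _≡ᵇ_; _/_)
open import Data.Nat.Divisibility using (_∣?_)
open import Data.List using (List; []; _∷_; map; filter; upTo; length; _++_)
open import Data.Nat.ListAction using (sum; product)
open import Data.Bool.ListAction using (any)
open import Data.Product using (_×_; _,_)
open import Relation.Nullary.Decidable using (⌊_⌋)

divisors : ℕ → List ℕ
divisors n = filter (λ d → d ∣? n) (map suc (upTo n))

adj : ℕ → ℕ → Bool
adj u v = not (u ≡ᵇ v) ∧ (⌊ u ∣? v ⌋ ∨ ⌊ v ∣? u ⌋)

reach : List ℕ → ℕ → ℕ → ℕ → Bool
reach V zero    u v = u ≡ᵇ v
reach V (suc d) u v = reach V d u v ∨ any (λ w → reach V d u w ∧ adj w v) V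

-- Least d ≤ b (searching upward from start s) with reach V d u v;
-- returns s + b if none is found.
search : List ℕ → ℕ → ℕ → ℕ → ℕ → ℕ
search V zero    s u v = s
search V (suc b) s u v = if reach V s u v then s else search V b (suc s) u v

-- In a connected graph on |V| vertices it is < |V|, so searching
-- d = 0,…,|V| suffices (the graph here is connected: 1 is adjacent to all).
dist : List ℕ → ℕ → ℕ → ℕ
dist V u v = search V (length V) 0 u v

pairs : List ℕ → List (ℕ × ℕ)
pairs []       = []
pairs (x ∷ xs) = map (λ y → (x , y)) xs ++ pairs xs

-- Hyper-Wiener index of the graph on vertex list V:
--   WW = (1/2) Σ_{unordered pairs} (d + d²),
-- computed termwise as (d + d²)/2, which is exact since d + d² is even.
hyperWiener : List ℕ → ℕ
hyperWiener V = sum (map (λ { (u , v) → (dist V u v + dist V u v * dist V u v) / 2 }) (pairs V))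

WWdivisorGraph : List ℕ → ℕ
WWdivisorGraph ps = hyperWiener (divisors (product ps))

-- Since 1 divides every vertex, any two divisors are at distance 1 if one divides
-- the other and 2 otherwise; so a pair {x, y} contributes (d + d²)/2 = 1 or 3 to WW.
-- Summing over ordered pairs, the contribution of (x, y) plus 2[x ∣ y] + 2[y ∣ x] is
-- always 3 + [x = y], whence 2 WW + 4 D = 3 N² + N, where N = 2^k is the number of
-- divisors and D is the number of ordered pairs x ∣ y.  Such a pair is a choice, for
-- each prime, of whether it divides neither, only y, or both, so D = 3^k.
module Submission where

open import Data.Bool using (Bool; true; false; not; _∧_; _∨_; if_then_else_)
open import Data.Bool.Properties using (∨-comm; ∨-zeroʳ; ∨-inverseʳ; ∧-identityʳ; ∧-zeroʳ)
open import Data.Bool.ListAction using (any)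
import Data.Integer as ℤ
import Data.Integer.Properties as ℤ
import Data.Integer.Tactic.RingSolver as ℤ-Solver
open import Data.List using (List; []; _∷_; _++_; map; length; upTo)
open import Data.List.Properties using (map-++; map-∘; map-cong-local; length-++; length-map)
open import Data.List.Membership.Propositional using (_∈_; _∉_)
open import Data.List.Membership.Propositional.Properties
  using (∈-++⁻; ∈-++⁺ˡ; ∈-++⁺ʳ; ∈-map⁺; ∈-map⁻; ∈-filter⁺; ∈-filter⁻; ∈-upTo⁺)
open import Data.List.Membership.Propositional.Properties.WithK using (unique∧set⇒bag)
open import Data.List.Relation.Binary.BagAndSetEquality using (∼bag⇒↭)
open import Data.List.Relation.Binary.Permutation.Propositional using (_↭_)
open import Data.List.Relation.Binary.Permutation.Propositional.Properties using (map⁺; ↭-length)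
open import Data.List.Relation.Unary.All as All using (All; []; _∷_)
open import Data.List.Relation.Unary.Any using (here; there)
open import Data.List.Relation.Unary.Unique.Propositional using (Unique; []; _∷_)
import Data.List.Relation.Unary.Unique.Propositional.Properties as Unique
open import Data.Nat
open import Data.Nat.Properties
open import Data.Nat.Divisibility
open import Data.Nat.Coprimality using (Coprime; coprime-divisor)
open import Data.Nat.Primality
  using (Prime; euclidsLemma; prime⇒irreducible; prime⇒nonZero; ¬prime[1]; productOfPrimes≢0)
open import Data.Nat.ListAction using (sum; product)
open import Data.Nat.ListAction.Properties using (sum-++; sum-↭)
open import Data.Nat.Tactic.RingSolver using (solve-∀)
open import Data.Product using (_×_; _,_; proj₂; ∃; uncurry)
open import Data.Sum using (inj₁; inj₂)
open import Function using (_∘_; _⇔_; mk⇔)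
open import Relation.Nullary using (¬_; Dec; does; yes; no; contradiction)
open import Relation.Nullary.Decidable using (⌊_⌋; isYes≗does; dec-true; dec-false; does-⇔)
open import Relation.Binary.Definitions using (DecidableEquality)
open import Relation.Binary.PropositionalEquality
open ≡-Reasoning

open import Defs

∑ : {A : Set} → List A → (A → ℕ) → ℕ
∑ xs f = sum (map f xs)

syntax ∑ xs (λ x → e) = ∑[ x ∈ xs ] e

module _ {A : Set} where

  ∑-cong : ∀ {xs : List A} {f g} → (∀ {x} → x ∈ xs → f x ≡ g x) → ∑ xs f ≡ ∑ xs g
  ∑-cong f≗g = cong sum (map-cong-local (All.tabulate f≗g))

  ∑-++ : ∀ (xs ys : List A) f → ∑ (xs ++ ys) f ≡ ∑ xs f + ∑ ys f
  ∑-++ xs ys f = trans (cong sum (map-++ f xs ys)) (sum-++ (map f xs) (map f ys))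

  ∑-map : ∀ {B : Set} (h : B → A) xs f → ∑ (map h xs) f ≡ ∑ xs (f ∘ h)
  ∑-map h xs f = cong sum (sym (map-∘ xs))

  ∑-+ : ∀ (xs : List A) f g → ∑[ x ∈ xs ] (f x + g x) ≡ ∑ xs f + ∑ xs g
  ∑-+ []       f g = refl
  ∑-+ (x ∷ xs) f g = trans (cong (f x + g x +_) (∑-+ xs f g)) (interchange (f x) (g x) _ _)
    where
    interchange : ∀ a b c d → a + b + (c + d) ≡ (a + c) + (b + d)
    interchange = solve-∀

  ∑-*ˡ : ∀ (xs : List A) c f → ∑[ x ∈ xs ] (c * f x) ≡ c * ∑ xs f
  ∑-*ˡ []       c f = sym (*-zeroʳ c)
  ∑-*ˡ (x ∷ xs) c f = trans (cong (c * f x +_) (∑-*ˡ xs c f)) (sym (*-distribˡ-+ c (f x) _))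

  ∑-const : ∀ (xs : List A) c → ∑[ _ ∈ xs ] c ≡ c * length xs
  ∑-const []       c = sym (*-zeroʳ c)
  ∑-const (x ∷ xs) c = trans (cong (c +_) (∑-const xs c)) (sym (*-suc c (length xs)))

  ∑-comm : ∀ (xs ys : List A) (f : A → A → ℕ) →
           ∑[ x ∈ xs ] ∑[ y ∈ ys ] f x y ≡ ∑[ y ∈ ys ] ∑[ x ∈ xs ] f x y
  ∑-comm []       ys f = sym (∑-const ys 0)
  ∑-comm (x ∷ xs) ys f = trans (cong (∑ ys (f x) +_) (∑-comm xs ys f))
                               (sym (∑-+ ys (f x) (λ y → ∑[ x ∈ xs ] f x y)))

  ∑-↭ : ∀ {xs ys : List A} f → xs ↭ ys → ∑ xs f ≡ ∑ ys f
  ∑-↭ f xs↭ys = sum-↭ (map⁺ f xs↭ys)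

  ∑-++-map : ∀ (xs : List A) (h : A → A) f → ∑ (xs ++ map h xs) f ≡ ∑ xs f + ∑ xs (f ∘ h)
  ∑-++-map xs h f = trans (∑-++ xs (map h xs) f) (cong (∑ xs f +_) (∑-map h xs f))

  unique∧set⇒↭ : ∀ {xs ys : List A} → Unique xs → Unique ys →
                 (∀ {x} → x ∈ xs ⇔ x ∈ ys) → xs ↭ ys
  unique∧set⇒↭ xs! ys! xs≈ys = ∼bag⇒↭ (unique∧set⇒bag xs! ys! xs≈ys)

  length≥2 : ∀ {V : List A} {x y} → x ∈ V → y ∈ V → x ≢ y → ∃ λ b → length V ≡ 2 + b
  length≥2 {_ ∷ _ ∷ V} _           _           _   = length V , refl
  length≥2 {_ ∷ []}    (here refl) (here refl) x≢y = contradiction refl x≢y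
  length≥2 {_ ∷ []}    (there ())  _           _
  length≥2 {_ ∷ []}    (here _)    (there ())  _

𝟙 : ∀ {P : Set} → Dec P → ℕ
𝟙 p? = if does p? then 1 else 0

module _ {P : Set} where

  𝟙-yes : (p? : Dec P) → P → 𝟙 p? ≡ 1
  𝟙-yes p? p = cong (λ b → if b then 1 else 0) (dec-true p? p)

  𝟙-no : (p? : Dec P) → ¬ P → 𝟙 p? ≡ 0
  𝟙-no p? ¬p = cong (λ b → if b then 1 else 0) (dec-false p? ¬p)

  𝟙-⇔ : ∀ {Q : Set} → P ⇔ Q → (p? : Dec P) (q? : Dec Q) → 𝟙 p? ≡ 𝟙 q?
  𝟙-⇔ P⇔Q p? q? = cong (λ b → if b then 1 else 0) (does-⇔ P⇔Q p? q?)

module _ {A : Set} (_≟ᴬ_ : DecidableEquality A) where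

  ∑-𝟙-≡ : ∀ {x xs} → Unique xs → x ∈ xs → ∑[ y ∈ xs ] 𝟙 (x ≟ᴬ y) ≡ 1
  ∑-𝟙-≡ {x} {_ ∷ xs} (x∉xs ∷ _) (here refl) = cong₂ _+_ (𝟙-yes (x ≟ᴬ x) refl) (begin
    ∑[ y ∈ xs ] 𝟙 (x ≟ᴬ y) ≡⟨ ∑-cong (λ y∈xs → 𝟙-no (x ≟ᴬ _) (All.lookup x∉xs y∈xs)) ⟩
    ∑[ _ ∈ xs ] 0          ≡⟨ ∑-const xs 0 ⟩
    0                      ∎)
  ∑-𝟙-≡ {x} {z ∷ _} (z∉xs ∷ xs!) (there x∈xs) =
    cong₂ _+_ (𝟙-no (x ≟ᴬ z) (All.lookup z∉xs x∈xs ∘ sym)) (∑-𝟙-≡ xs! x∈xs)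

module _ {A : Set} where

  ∑-+-*ˡ : ∀ (xs : List A) f c g → ∑[ x ∈ xs ] (f x + c * g x) ≡ ∑ xs f + c * ∑ xs g
  ∑-+-*ˡ xs f c g = trans (∑-+ xs f (λ x → c * g x)) (cong (∑ xs f +_) (∑-*ˡ xs c g))

  ∑∑-+-transpose : ∀ (V : List A) (f g : A → A → ℕ) →
    ∑[ x ∈ V ] ∑[ y ∈ V ] (f x y + 2 * g x y + 2 * g y x)
      ≡ ∑[ x ∈ V ] ∑[ y ∈ V ] f x y + 2 * ∑[ x ∈ V ] ∑[ y ∈ V ] g x y + 2 * ∑[ x ∈ V ] ∑[ y ∈ V ] g x y
  ∑∑-+-transpose V f g = begin
    ∑[ x ∈ V ] ∑[ y ∈ V ] (f x y + 2 * g x y + 2 * g y x)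
      ≡⟨ ∑-cong {xs = V} (λ {x} _ → split (f x) (g x) (λ y → g y x)) ⟩
    ∑[ x ∈ V ] (∑ V (f x) + 2 * ∑ V (g x) + 2 * ∑[ y ∈ V ] g y x)
      ≡⟨ split (λ x → ∑ V (f x)) (λ x → ∑ V (g x)) (λ x → ∑[ y ∈ V ] g y x) ⟩
    ∑[ x ∈ V ] ∑[ y ∈ V ] f x y + 2 * ∑[ x ∈ V ] ∑[ y ∈ V ] g x y + 2 * ∑[ x ∈ V ] ∑[ y ∈ V ] g y x
      ≡⟨ cong (λ s → ∑[ x ∈ V ] ∑[ y ∈ V ] f x y + 2 * ∑[ x ∈ V ] ∑[ y ∈ V ] g x y + 2 * s) (sym (∑-comm V V g)) ⟩
    ∑[ x ∈ V ] ∑[ y ∈ V ] f x y + 2 * ∑[ x ∈ V ] ∑[ y ∈ V ] g x y + 2 * ∑[ x ∈ V ] ∑[ y ∈ V ] g x y ∎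
    where
    split : ∀ a b c → ∑[ x ∈ V ] (a x + 2 * b x + 2 * c x) ≡ ∑ V a + 2 * ∑ V b + 2 * ∑ V c
    split a b c = trans (∑-+-*ˡ V (λ x → a x + 2 * b x) 2 c) (cong (_+ 2 * ∑ V c) (∑-+-*ˡ V a 2 b))

∈-pairs⁻ : ∀ {x y} L → (x , y) ∈ pairs L → x ∈ L × y ∈ L
∈-pairs⁻ (z ∷ L) p∈ with ∈-++⁻ (map (z ,_) L) p∈
... | inj₁ p∈head with ∈-map⁻ (z ,_) p∈head
...   | _ , y∈L , refl = here refl , there y∈L
∈-pairs⁻ (z ∷ L) p∈ | inj₂ p∈tail with ∈-pairs⁻ L p∈tail
...   | x∈L , y∈L = there x∈L , there y∈L

∑-pairs : ∀ (f : ℕ → ℕ → ℕ) → (∀ x y → f x y ≡ f y x) → (∀ x → f x x ≡ 0) →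
          ∀ L → 2 * ∑ (pairs L) (uncurry f) ≡ ∑[ x ∈ L ] ∑[ y ∈ L ] f x y
∑-pairs f f-sym f-diag []      = refl
∑-pairs f f-sym f-diag (x ∷ L) = begin
  2 * ∑ (map (x ,_) L ++ pairs L) (uncurry f)
    ≡⟨ cong (2 *_) (trans (∑-++ (map (x ,_) L) (pairs L) _) (cong (_+ P) (∑-map (x ,_) L _))) ⟩
  2 * (R + P)
    ≡⟨ regroup R P ⟩
  R + (R + 2 * P)
    ≡⟨ cong₂ (λ a b → a + (b + 2 * P)) (cong (_+ R) (sym (f-diag x))) (∑-cong {xs = L} λ {y} _ → f-sym x y) ⟩
  (f x x + R) + (∑[ y ∈ L ] f y x + 2 * P)
    ≡⟨ cong (λ s → (f x x + R) + (∑[ y ∈ L ] f y x + s)) (∑-pairs f f-sym f-diag L) ⟩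
  (f x x + R) + (∑[ y ∈ L ] f y x + ∑[ y ∈ L ] ∑[ z ∈ L ] f y z)
    ≡⟨ cong ((f x x + R) +_) (sym (∑-+ L (λ y → f y x) (λ y → ∑ L (f y)))) ⟩
  ∑[ y ∈ x ∷ L ] ∑[ z ∈ x ∷ L ] f y z ∎
  where
  R = ∑ L (f x)
  P = ∑ (pairs L) (uncurry f)
  regroup : ∀ r p → 2 * (r + p) ≡ r + (r + 2 * p)
  regroup = solve-∀

module _ {A : Set} (p : A → Bool) where

  any-true : ∀ {x xs} → x ∈ xs → p x ≡ true → any p xs ≡ true
  any-true {xs = _ ∷ xs} (here refl) px = cong (_∨ any p xs) px
  any-true {xs = y ∷ _}  (there x∈)  px = trans (cong (p y ∨_) (any-true x∈ px)) (∨-zeroʳ (p y))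

  any-false : ∀ {xs} → (∀ {x} → x ∈ xs → p x ≡ false) → any p xs ≡ false
  any-false {[]}     _  = refl
  any-false {y ∷ xs} px = cong₂ _∨_ (px (here refl)) (any-false (px ∘ there))

≡ᵇ-refl : ∀ n → (n ≡ᵇ n) ≡ true
≡ᵇ-refl n = dec-true (n ≟ n) refl

≢⇒≡ᵇ-false : ∀ {m n} → m ≢ n → (m ≡ᵇ n) ≡ false
≢⇒≡ᵇ-false {m} {n} = dec-false (m ≟ n)

any-≡ᵇ : ∀ (f : ℕ → Bool) {u V} → u ∈ V → any (λ w → (u ≡ᵇ w) ∧ f w) V ≡ f u
any-≡ᵇ f {u} {V} u∈V with f u in fu
... | true  = any-true (λ w → (u ≡ᵇ w) ∧ f w) u∈V (trans (cong ((u ≡ᵇ u) ∧_) fu) (cong (_∧ true) (≡ᵇ-refl u)))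
... | false = any-false (λ w → (u ≡ᵇ w) ∧ f w) {V} λ {w} _ → only-u w
  where
  only-u : ∀ w → (u ≡ᵇ w) ∧ f w ≡ false
  only-u w with u ≟ w
  ... | yes refl = trans (cong ((u ≡ᵇ u) ∧_) fu) (∧-zeroʳ (u ≡ᵇ u))
  ... | no u≢w   = cong (_∧ f w) (≢⇒≡ᵇ-false u≢w)

⌊⌋-true : ∀ {P : Set} (p? : Dec P) → P → ⌊ p? ⌋ ≡ true
⌊⌋-true p? p = trans (isYes≗does p?) (dec-true p? p)

comparable? : ℕ → ℕ → Bool
comparable? u v = ⌊ u ∣? v ⌋ ∨ ⌊ v ∣? u ⌋

adj-1ʳ : ∀ u → adj u 1 ≡ not (u ≡ᵇ 1)
adj-1ʳ u = begin
  not (u ≡ᵇ 1) ∧ (⌊ u ∣? 1 ⌋ ∨ ⌊ 1 ∣? u ⌋) ≡⟨ cong (λ b → not (u ≡ᵇ 1) ∧ (⌊ u ∣? 1 ⌋ ∨ b)) (⌊⌋-true (1 ∣? u) (1∣ u)) ⟩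
  not (u ≡ᵇ 1) ∧ (⌊ u ∣? 1 ⌋ ∨ true)          ≡⟨ cong (not (u ≡ᵇ 1) ∧_) (∨-zeroʳ _) ⟩
  not (u ≡ᵇ 1) ∧ true                            ≡⟨ ∧-identityʳ _ ⟩
  not (u ≡ᵇ 1)                                   ∎

adj-1ˡ : ∀ v → adj 1 v ≡ not (1 ≡ᵇ v)
adj-1ˡ v = trans (cong (λ b → not (1 ≡ᵇ v) ∧ (b ∨ ⌊ v ∣? 1 ⌋)) (⌊⌋-true (1 ∣? v) (1∣ v))) (∧-identityʳ _)

module _ {V : List ℕ} where

  reach-1 : ∀ {u} v → u ∈ V → reach V 1 u v ≡ (u ≡ᵇ v) ∨ adj u v
  reach-1 {u} v u∈V = cong ((u ≡ᵇ v) ∨_) (any-≡ᵇ (λ w → adj w v) u∈V)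

  reach-1-≢ : ∀ {u v} → u ∈ V → u ≢ v → reach V 1 u v ≡ comparable? u v
  reach-1-≢ {u} {v} u∈V u≢v =
    trans (reach-1 v u∈V) (cong (λ b → b ∨ (not b ∧ comparable? u v)) (≢⇒≡ᵇ-false u≢v))

  reach-1-to-1 : ∀ {u} → u ∈ V → reach V 1 u 1 ≡ true
  reach-1-to-1 {u} u∈V = begin
    reach V 1 u 1              ≡⟨ reach-1 1 u∈V ⟩
    (u ≡ᵇ 1) ∨ adj u 1         ≡⟨ cong ((u ≡ᵇ 1) ∨_) (adj-1ʳ u) ⟩
    (u ≡ᵇ 1) ∨ not (u ≡ᵇ 1)    ≡⟨ ∨-inverseʳ (u ≡ᵇ 1) ⟩
    true                       ∎

  reach-2 : ∀ {u} v → u ∈ V → 1 ∈ V → reach V 2 u v ≡ true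
  reach-2 {u} v u∈V 1∈V with 1 ≟ v
  ... | yes refl = cong (_∨ any (λ w → reach V 1 u w ∧ adj w 1) V) (reach-1-to-1 u∈V)
  ... | no 1≢v   = trans (cong (reach V 1 u v ∨_) (any-true _ 1∈V via-1)) (∨-zeroʳ _)
    where
    via-1 : reach V 1 u 1 ∧ adj 1 v ≡ true
    via-1 = cong₂ _∧_ (reach-1-to-1 u∈V) (trans (adj-1ˡ v) (cong not (≢⇒≡ᵇ-false 1≢v)))

  search-hit : ∀ {s u v} b → reach V s u v ≡ true → search V b s u v ≡ s
  search-hit zero    _   = refl
  search-hit {s} {u} {v} (suc b) hit = cong (λ c → if c then s else search V b (suc s) u v) hit

  search-miss : ∀ {s u v} b → reach V s u v ≡ false → search V (suc b) s u v ≡ search V b (suc s) u v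
  search-miss {s} {u} {v} b miss = cong (λ c → if c then s else search V b (suc s) u v) miss

divisorDistance : ℕ → ℕ → ℕ
divisorDistance u v = if u ≡ᵇ v then 0 else if comparable? u v then 1 else 2

dist≡divisorDistance : ∀ {V u v} → u ∈ V → v ∈ V → 1 ∈ V → dist V u v ≡ divisorDistance u v
dist≡divisorDistance {V} {u} {v} u∈V v∈V 1∈V with u ≟ v
... | yes refl rewrite ≡ᵇ-refl u = search-hit (length V) (≡ᵇ-refl u)
... | no u≢v rewrite ≢⇒≡ᵇ-false u≢v with length≥2 u∈V v∈V u≢v
...   | b , |V|≡2+b = begin
  search V (length V) 0 u v  ≡⟨ cong (λ n → search V n 0 u v) |V|≡2+b ⟩
  search V (2 + b) 0 u v     ≡⟨ search-miss (suc b) (≢⇒≡ᵇ-false u≢v) ⟩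
  search V (1 + b) 1 u v     ≡⟨ from-1 ⟩
  (if comparable? u v then 1 else 2) ∎
  where
  from-1 : search V (1 + b) 1 u v ≡ (if comparable? u v then 1 else 2)
  from-1 with comparable? u v in cmp
  ... | true  = search-hit (suc b) (trans (reach-1-≢ u∈V u≢v) cmp)
  ... | false = trans (search-miss b (trans (reach-1-≢ u∈V u≢v) cmp)) (search-hit b (reach-2 v u∈V 1∈V))

divisorDistance-sym : ∀ u v → divisorDistance u v ≡ divisorDistance v u
divisorDistance-sym u v with u ≟ v
... | yes refl = refl
... | no u≢v rewrite ≢⇒≡ᵇ-false u≢v | ≢⇒≡ᵇ-false (u≢v ∘ sym) | ∨-comm ⌊ u ∣? v ⌋ ⌊ v ∣? u ⌋ = refl

divisorDistance-self : ∀ u → divisorDistance u u ≡ 0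
divisorDistance-self u rewrite ≡ᵇ-refl u = refl

hyperWienerTerm : ℕ → ℕ
hyperWienerTerm d = (d + d * d) / 2

divisorWeight : ℕ → ℕ → ℕ
divisorWeight u v = hyperWienerTerm (divisorDistance u v)

2*hyperWiener≡∑∑divisorWeight : ∀ {V} → 1 ∈ V → 2 * hyperWiener V ≡ ∑[ x ∈ V ] ∑[ y ∈ V ] divisorWeight x y
2*hyperWiener≡∑∑divisorWeight {V} 1∈V = begin
  2 * hyperWiener V
    ≡⟨ cong (2 *_) (∑-cong {xs = pairs V} λ { {u , v} uv∈ → cong hyperWienerTerm (on-pairs u v uv∈) }) ⟩
  2 * ∑ (pairs V) (uncurry divisorWeight)
    ≡⟨ ∑-pairs divisorWeight (λ u v → cong hyperWienerTerm (divisorDistance-sym u v))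
                              (λ u → cong hyperWienerTerm (divisorDistance-self u)) V ⟩
  ∑[ x ∈ V ] ∑[ y ∈ V ] divisorWeight x y ∎
  where
  on-pairs : ∀ u v → (u , v) ∈ pairs V → dist V u v ≡ divisorDistance u v
  on-pairs u v uv∈ with ∈-pairs⁻ V uv∈
  ... | u∈V , v∈V = dist≡divisorDistance u∈V v∈V 1∈V

divisibilityPairs : List ℕ → ℕ
divisibilityPairs V = ∑[ x ∈ V ] ∑[ y ∈ V ] 𝟙 (x ∣? y)

divisorWeight+indicators : ∀ x y → divisorWeight x y + 2 * 𝟙 (x ∣? y) + 2 * 𝟙 (y ∣? x) ≡ 3 + 𝟙 (x ≟ y)
divisorWeight+indicators x y with x ≟ y
... | yes refl rewrite ≡ᵇ-refl x | 𝟙-yes (x ∣? x) ∣-refl = refl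
... | no x≢y rewrite ≢⇒≡ᵇ-false x≢y with x ∣? y | y ∣? x
...   | yes x∣y | yes y∣x = contradiction (∣-antisym x∣y y∣x) x≢y
...   | yes _   | no _    = refl
...   | no _    | yes _   = refl
...   | no _    | no _    = refl

hyperWiener-divisorGraph : ∀ {V} → Unique V → 1 ∈ V →
  2 * hyperWiener V + 4 * divisibilityPairs V ≡ (3 * length V + 1) * length V
hyperWiener-divisorGraph {V} V! 1∈V = begin
  2 * hyperWiener V + 4 * D
    ≡⟨ cong₂ _+_ (2*hyperWiener≡∑∑divisorWeight 1∈V) (*-distribʳ-+ D 2 2) ⟩
  ∑[ x ∈ V ] ∑[ y ∈ V ] divisorWeight x y + (2 * D + 2 * D)
    ≡⟨ sym (+-assoc (∑[ x ∈ V ] ∑[ y ∈ V ] divisorWeight x y) (2 * D) (2 * D)) ⟩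
  ∑[ x ∈ V ] ∑[ y ∈ V ] divisorWeight x y + 2 * D + 2 * D
    ≡⟨ sym (∑∑-+-transpose V divisorWeight (λ x y → 𝟙 (x ∣? y))) ⟩
  ∑[ x ∈ V ] ∑[ y ∈ V ] (divisorWeight x y + 2 * 𝟙 (x ∣? y) + 2 * 𝟙 (y ∣? x))
    ≡⟨ ∑-cong {xs = V} (λ {x} _ → ∑-cong {xs = V} (λ {y} _ → divisorWeight+indicators x y)) ⟩
  ∑[ x ∈ V ] ∑[ y ∈ V ] (3 + 𝟙 (x ≟ y))
    ≡⟨ ∑-cong {xs = V} (λ {x} x∈V → trans (∑-+ V (λ _ → 3) (λ y → 𝟙 (x ≟ y)))
                                          (cong₂ _+_ (∑-const V 3) (∑-𝟙-≡ _≟_ V! x∈V))) ⟩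
  ∑[ _ ∈ V ] (3 * length V + 1)
    ≡⟨ ∑-const V (3 * length V + 1) ⟩
  (3 * length V + 1) * length V ∎
  where
  D = divisibilityPairs V

prime∤product : ∀ {p ps} → Prime p → All Prime ps → p ∉ ps → p ∤ product ps
prime∤product {ps = []}     p-prime _              _   p∣1 = ¬prime[1] (subst Prime (∣1⇒≡1 p∣1) p-prime)
prime∤product {ps = q ∷ qs} p-prime (q-prime ∷ qs-prime) p∉ps p∣qQ
  with euclidsLemma q (product qs) p-prime p∣qQ
... | inj₂ p∣Q = prime∤product p-prime qs-prime (p∉ps ∘ there) p∣Q
... | inj₁ p∣q with prime⇒irreducible q-prime p∣q
...   | inj₁ p≡1 = ¬prime[1] (subst Prime p≡1 p-prime)
...   | inj₂ p≡q = p∉ps (here p≡q)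

prime∤⇒coprime : ∀ {p m} → Prime p → p ∤ m → Coprime m p
prime∤⇒coprime p-prime p∤m (d∣m , d∣p) with prime⇒irreducible p-prime d∣p
... | inj₁ d≡1    = d≡1
... | inj₂ refl   = contradiction d∣m p∤m

subsetProducts : List ℕ → List ℕ
subsetProducts []       = 1 ∷ []
subsetProducts (p ∷ ps) = subsetProducts ps ++ map (p *_) (subsetProducts ps)

length-subsetProducts : ∀ ps → length (subsetProducts ps) ≡ 2 ^ length ps
length-subsetProducts []       = refl
length-subsetProducts (p ∷ ps) = begin
  length (subsetProducts ps ++ map (p *_) (subsetProducts ps))
    ≡⟨ length-++ (subsetProducts ps) ⟩
  length (subsetProducts ps) + length (map (p *_) (subsetProducts ps))
    ≡⟨ cong (length (subsetProducts ps) +_) (length-map (p *_) (subsetProducts ps)) ⟩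
  length (subsetProducts ps) + length (subsetProducts ps)
    ≡⟨ cong (λ n → n + n) (length-subsetProducts ps) ⟩
  2 ^ length ps + 2 ^ length ps
    ≡⟨ cong (2 ^ length ps +_) (+-identityʳ _) ⟨
  2 ^ length ps + (2 ^ length ps + 0) ∎

∈-subsetProducts⇒∣ : ∀ ps {x} → x ∈ subsetProducts ps → x ∣ product ps
∈-subsetProducts⇒∣ []       (here refl) = ∣-refl
∈-subsetProducts⇒∣ (p ∷ ps) x∈ with ∈-++⁻ (subsetProducts ps) x∈
... | inj₁ x∈ps  = ∣n⇒∣m*n p (∈-subsetProducts⇒∣ ps x∈ps)
... | inj₂ x∈pps with ∈-map⁻ (p *_) x∈pps
...   | y , y∈ps , refl = *-monoʳ-∣ p (∈-subsetProducts⇒∣ ps y∈ps)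

module _ {p ps} (p-prime : Prime p) (ps-prime : All Prime ps) (p∉ps : p ∉ ps) where

  private instance
    p≢0 : NonZero p
    p≢0 = prime⇒nonZero p-prime

  prime∤subsetProduct : ∀ {a} → a ∈ subsetProducts ps → p ∤ a
  prime∤subsetProduct a∈ p∣a = prime∤product p-prime ps-prime p∉ps (∣-trans p∣a (∈-subsetProducts⇒∣ ps a∈))

  divisibilityPairs-subsetProducts-∷ :
    divisibilityPairs (subsetProducts (p ∷ ps)) ≡ 3 * divisibilityPairs (subsetProducts ps)
  divisibilityPairs-subsetProducts-∷ = begin
    ∑[ x ∈ A ++ map (p *_) A ] ∑[ y ∈ A ++ map (p *_) A ] 𝟙 (x ∣? y)
      ≡⟨ ∑-++-map A (p *_) _ ⟩
    ∑[ a ∈ A ] ∑[ y ∈ A ++ map (p *_) A ] 𝟙 (a ∣? y) + ∑[ a ∈ A ] ∑[ y ∈ A ++ map (p *_) A ] 𝟙 (p * a ∣? y)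
      ≡⟨ cong₂ _+_ (∑-cong {xs = A} row-of-a) (∑-cong {xs = A} λ {a} _ → row-of-p*a a) ⟩
    ∑[ a ∈ A ] (row a + row a) + ∑ A row
      ≡⟨ cong (_+ D) (∑-+ A row row) ⟩
    D + D + D
      ≡⟨ triple D ⟩
    3 * D ∎
    where
    A = subsetProducts ps
    D = divisibilityPairs A
    row : ℕ → ℕ
    row a = ∑[ b ∈ A ] 𝟙 (a ∣? b)
    triple : ∀ d → d + d + d ≡ 3 * d
    triple = solve-∀

    row-of-a : ∀ {a} → a ∈ A → ∑[ y ∈ A ++ map (p *_) A ] 𝟙 (a ∣? y) ≡ row a + row a
    row-of-a {a} a∈ = trans (∑-++-map A (p *_) _) (cong (row a +_) (∑-cong {xs = A} λ {b} _ → a∣p*b⇔a∣b b))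
      where
      a∣p*b⇔a∣b : ∀ b → 𝟙 (a ∣? p * b) ≡ 𝟙 (a ∣? b)
      a∣p*b⇔a∣b b = 𝟙-⇔ (mk⇔ (coprime-divisor (prime∤⇒coprime p-prime (prime∤subsetProduct a∈))) (∣n⇒∣m*n p))
                         (a ∣? p * b) (a ∣? b)

    row-of-p*a : ∀ a → ∑[ y ∈ A ++ map (p *_) A ] 𝟙 (p * a ∣? y) ≡ row a
    row-of-p*a a = begin
      ∑[ y ∈ A ++ map (p *_) A ] 𝟙 (p * a ∣? y)         ≡⟨ ∑-++-map A (p *_) _ ⟩
      ∑[ b ∈ A ] 𝟙 (p * a ∣? b) + ∑[ b ∈ A ] 𝟙 (p * a ∣? p * b)
        ≡⟨ cong₂ _+_ (trans (∑-cong {xs = A} p*a∤b) (∑-const A 0)) (∑-cong {xs = A} λ {b} _ → p*a∣p*b⇔a∣b b) ⟩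
      row a                                             ∎
      where
      p*a∤b : ∀ {b} → b ∈ A → 𝟙 (p * a ∣? b) ≡ 0
      p*a∤b {b} b∈ = 𝟙-no (p * a ∣? b) (λ pa∣b → prime∤subsetProduct b∈ (∣-trans (m∣m*n a) pa∣b))
      p*a∣p*b⇔a∣b : ∀ b → 𝟙 (p * a ∣? p * b) ≡ 𝟙 (a ∣? b)
      p*a∣p*b⇔a∣b b = 𝟙-⇔ (mk⇔ (*-cancelˡ-∣ p) (*-monoʳ-∣ p)) (p * a ∣? p * b) (a ∣? b)

  ∣⇒∈-subsetProducts-∷ : (∀ {y} → y ∣ product ps → y ∈ subsetProducts ps) →
                         ∀ {x} → x ∣ p * product ps → x ∈ subsetProducts (p ∷ ps)
  ∣⇒∈-subsetProducts-∷ ih {x} x∣pP with p ∣? x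
  ... | no p∤x = ∈-++⁺ˡ (ih (coprime-divisor (prime∤⇒coprime p-prime p∤x) x∣pP))
  ... | yes (divides q refl) =
    ∈-++⁺ʳ (subsetProducts ps) (subst (_∈ map (p *_) (subsetProducts ps)) (*-comm p q) (∈-map⁺ (p *_) (ih q∣P)))
    where
    q∣P : q ∣ product ps
    q∣P = *-cancelˡ-∣ p (subst (_∣ p * product ps) (*-comm q p) x∣pP)

  subsetProducts-unique-∷ : Unique (subsetProducts ps) → Unique (subsetProducts (p ∷ ps))
  subsetProducts-unique-∷ A! = Unique.++⁺ A! (Unique.map⁺ (*-cancelˡ-≡ _ _ p) A!) disjoint
    where
    disjoint : ∀ {v} → ¬ (v ∈ subsetProducts ps × v ∈ map (p *_) (subsetProducts ps))
    disjoint (v∈ , v∈pA) with ∈-map⁻ (p *_) v∈pA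
    ... | a , _ , refl = prime∤subsetProduct v∈ (m∣m*n a)

∣⇒∈-subsetProducts : ∀ {ps x} → All Prime ps → Unique ps → x ∣ product ps → x ∈ subsetProducts ps
∣⇒∈-subsetProducts {[]}     _                    _   x∣1 = here (∣1⇒≡1 x∣1)
∣⇒∈-subsetProducts {p ∷ ps} (p-prime ∷ ps-prime) p∷ps!@(_ ∷ ps!) =
  ∣⇒∈-subsetProducts-∷ p-prime ps-prime (Unique.Unique[x∷xs]⇒x∉xs p∷ps!)
    (∣⇒∈-subsetProducts ps-prime ps!)

subsetProducts-unique : ∀ {ps} → All Prime ps → Unique ps → Unique (subsetProducts ps)
subsetProducts-unique {[]}     _                    _   = [] ∷ []
subsetProducts-unique {p ∷ ps} (p-prime ∷ ps-prime) p∷ps!@(_ ∷ ps!) =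
  subsetProducts-unique-∷ p-prime ps-prime (Unique.Unique[x∷xs]⇒x∉xs p∷ps!)
    (subsetProducts-unique ps-prime ps!)

divisibilityPairs-subsetProducts : ∀ {ps} → All Prime ps → Unique ps →
                                   divisibilityPairs (subsetProducts ps) ≡ 3 ^ length ps
divisibilityPairs-subsetProducts {[]}     _                    _   = refl
divisibilityPairs-subsetProducts {p ∷ ps} (p-prime ∷ ps-prime) p∷ps!@(_ ∷ ps!) =
  trans (divisibilityPairs-subsetProducts-∷ p-prime ps-prime (Unique.Unique[x∷xs]⇒x∉xs p∷ps!))
        (cong (3 *_) (divisibilityPairs-subsetProducts ps-prime ps!))

divisors-unique : ∀ n → Unique (divisors n)
divisors-unique n = Unique.filter⁺ (_∣? n) (Unique.map⁺ suc-injective (Unique.upTo⁺ n))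

∈-divisors⇒∣ : ∀ {n d} → d ∈ divisors n → d ∣ n
∈-divisors⇒∣ {n} d∈ = proj₂ (∈-filter⁻ (_∣? n) {xs = map suc (upTo n)} d∈)

∣⇒∈-divisors : ∀ {n d} .{{_ : NonZero n}} → d ∣ n → d ∈ divisors n
∣⇒∈-divisors {n} {zero}  0∣n = contradiction (0∣⇒≡0 0∣n) (≢-nonZero⁻¹ n)
∣⇒∈-divisors {n} {suc d} d∣n = ∈-filter⁺ (_∣? n) (∈-map⁺ suc (∈-upTo⁺ (∣⇒≤ d∣n))) d∣n

divisors↭subsetProducts : ∀ {ps} → All Prime ps → Unique ps → divisors (product ps) ↭ subsetProducts ps
divisors↭subsetProducts {ps} ps-prime ps! =
  unique∧set⇒↭ (divisors-unique (product ps)) (subsetProducts-unique ps-prime ps!)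
    (mk⇔ (∣⇒∈-subsetProducts ps-prime ps! ∘ ∈-divisors⇒∣) (∣⇒∈-divisors ∘ ∈-subsetProducts⇒∣ ps))
  where instance _ = productOfPrimes≢0 ps-prime

divisibilityPairs-↭ : ∀ {xs ys} → xs ↭ ys → divisibilityPairs xs ≡ divisibilityPairs ys
divisibilityPairs-↭ {xs} {ys} xs↭ys =
  trans (∑-↭ (λ x → ∑[ y ∈ xs ] 𝟙 (x ∣? y)) xs↭ys)
        (∑-cong {xs = ys} (λ {x} _ → ∑-↭ (λ y → 𝟙 (x ∣? y)) xs↭ys))

WWdivisorGraph-formula : ∀ {ps} → All Prime ps → Unique ps →
  2 * WWdivisorGraph ps + 4 * 3 ^ length ps ≡ (3 * 2 ^ length ps + 1) * 2 ^ length ps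
WWdivisorGraph-formula {ps} ps-prime ps! = begin
  2 * hyperWiener V + 4 * 3 ^ length ps
    ≡⟨ cong (λ d → 2 * hyperWiener V + 4 * d) D≡3^k ⟨
  2 * hyperWiener V + 4 * divisibilityPairs V
    ≡⟨ hyperWiener-divisorGraph (divisors-unique (product ps)) (∣⇒∈-divisors (1∣ product ps)) ⟩
  (3 * length V + 1) * length V
    ≡⟨ cong (λ n → (3 * n + 1) * n) N≡2^k ⟩
  (3 * 2 ^ length ps + 1) * 2 ^ length ps ∎
  where
  instance _ = productOfPrimes≢0 ps-prime
  V = divisors (product ps)
  V↭ = divisors↭subsetProducts ps-prime ps!
  N≡2^k : length V ≡ 2 ^ length ps
  N≡2^k = trans (↭-length V↭) (length-subsetProducts ps)
  D≡3^k : divisibilityPairs V ≡ 3 ^ length ps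
  D≡3^k = trans (divisibilityPairs-↭ V↭) (divisibilityPairs-subsetProducts ps-prime ps!)

pos-moveʳ : ∀ {a b c} → a + b ≡ c → ℤ.+ a ≡ ℤ.+ c ℤ.- ℤ.+ b
pos-moveʳ {a} {b} {c} a+b≡c = begin
  ℤ.+ a                           ≡⟨ cancel (ℤ.+ a) (ℤ.+ b) ⟩
  (ℤ.+ a ℤ.+ ℤ.+ b) ℤ.- ℤ.+ b     ≡⟨ cong (ℤ._- ℤ.+ b) (ℤ.pos-+ a b) ⟨
  ℤ.+ (a + b) ℤ.- ℤ.+ b           ≡⟨ cong (λ n → ℤ.+ n ℤ.- ℤ.+ b) a+b≡c ⟩
  ℤ.+ c ℤ.- ℤ.+ b                 ∎
  where
  cancel : ∀ x y → x ≡ (x ℤ.+ y) ℤ.- y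
  cancel = ℤ-Solver.solve-∀

theorem3p4 : (ps : List ℕ) → All Prime ps → Unique ps →
    ℤ.+ 2 ℤ.* ℤ.+ WWdivisorGraph ps
    ≡ ℤ.+ (2 ^ length ps) ℤ.* (ℤ.+ (2 ^ (length ps + 1)) ℤ.+ ℤ.+ (2 ^ length ps) ℤ.+ ℤ.+ 1)
      ℤ.- ℤ.+ 4 ℤ.* ℤ.+ (3 ^ length ps)
theorem3p4 ps ps-prime ps! = begin
  ℤ.+ 2 ℤ.* ℤ.+ WW                             ≡⟨ ℤ.pos-* 2 WW ⟨
  ℤ.+ (2 * WW)                                 ≡⟨ pos-moveʳ (trans (WWdivisorGraph-formula ps-prime ps!) expand) ⟩
  ℤ.+ (N * (E + N + 1)) ℤ.- ℤ.+ (4 * Q)        ≡⟨ cong₂ ℤ._-_ (trans (ℤ.pos-* N _) (cong (ℤ.+ N ℤ.*_) cast)) (ℤ.pos-* 4 Q) ⟩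
  ℤ.+ N ℤ.* (ℤ.+ E ℤ.+ ℤ.+ N ℤ.+ ℤ.+ 1) ℤ.- ℤ.+ 4 ℤ.* ℤ.+ Q ∎
  where
  WW = WWdivisorGraph ps
  N = 2 ^ length ps
  Q = 3 ^ length ps
  E = 2 ^ (length ps + 1)
  expand : (3 * N + 1) * N ≡ N * (E + N + 1)
  expand = trans (regroup N) (cong (λ e → N * (e + N + 1)) (sym (^-distribˡ-+-* 2 (length ps) 1)))
    where
    regroup : ∀ n → (3 * n + 1) * n ≡ n * (n * 2 + n + 1)
    regroup = solve-∀
  cast : ℤ.+ (E + N + 1) ≡ ℤ.+ E ℤ.+ ℤ.+ N ℤ.+ ℤ.+ 1
  cast = trans (ℤ.pos-+ (E + N) 1) (cong (ℤ._+ ℤ.+ 1) (ℤ.pos-+ E N))
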